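{- Let $\Sigma$ be a totally ordered alphabet with $|\Sigma| > n$. Any read-once branching program that, on every input sequence $x \in \Sigma^n$, computes $\mathrm{LIS}(x)$ has size $2^{\Omega(n)}$.
   Context: For $x = x_1 \cdots x_n \in \Sigma^n$, $\mathrm{LIS}(x)$ denotes the length of a longest strictly increasing subsequence of $x$. A $|\Sigma|$-way branching program on inputs $x \in \Sigma^n$ is a directed acyclic rooted graph in which each non-sink node is labelled by an index $i \in [n]$ and has one out-edge for each symbol of $\Sigma$; on input $x$, computation starts at the root and at a node labelled $i$ follows the out-edge labelled $x_i$ (the program "queries" $x_i$), until reaching a sink, whose label is the output. The size is the number of nodes. It is read-once if along every computation path each index $i$ is queried at most once. -}

module Defs where

open import Data.Nat using (ℕ; _<_; _≤_)
open import Data.Fin using (Fin; toℕ)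
open import Data.List using (List; []; _∷_)
open import Data.List.Relation.Unary.Unique.Propositional using (Unique)
open import Data.Product using (Σ; _×_; ∃-syntax)
open import Relation.Binary.PropositionalEquality using (_≡_)

-- The alphabet Σ is Fin m, totally ordered by the usual order on Fin.
-- An input is x : Fin n → Fin m  (x i is x_{i+1}).
Input : ℕ → ℕ → Set
Input n m = Fin n → Fin m

IncSub : ∀ {n m} → Input n m → ℕ → Set
IncSub {n} x k =
  Σ (Fin k → Fin n) λ f →
    ∀ (i j : Fin k) → toℕ i < toℕ j →
      (toℕ (f i) < toℕ (f j)) × (toℕ (x (f i)) < toℕ (x (f j)))

IsLIS : ∀ {n m} → Input n m → ℕ → Set
IsLIS x k = IncSub x k × (∀ k' → IncSub x k' → k' ≤ k)

data Node (n m s : ℕ) : Set where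
  query : Fin n → (Fin m → Fin s) → Node n m s
  sink  : ℕ → Node n m s

-- A branching program of size s (nodes are Fin s). Acyclicity is
-- expressed by a topological order: every edge goes from u to a node
-- with larger index.
record BP (n m s : ℕ) : Set where
  field
    node    : Fin s → Node n m s
    root    : Fin s
    acyclic : ∀ u i e → node u ≡ query i e → ∀ a → toℕ u < toℕ (e a)
open BP public

data Run {n m s} (P : BP n m s) (x : Input n m) :
         Fin s → List (Fin n) → ℕ → Set where
  at-sink : ∀ {u v} → node P u ≡ sink v → Run P x u [] v
  step    : ∀ {u i e qs v} → node P u ≡ query i e →
            Run P x (e (x i)) qs v → Run P x u (i ∷ qs) v

ReadOnce : ∀ {n m s} → BP n m s → Set
ReadOnce {n} {m} P =
  ∀ (x : Input n m) qs v → Run P x (root P) qs v → Unique qs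

ComputesLIS : ∀ {n m s} → BP n m s → Set
ComputesLIS {n} {m} P =
  ∀ (x : Input n m) → ∃[ qs ] ∃[ v ] (Run P x (root P) qs v × IsLIS x v)

module Submission where

-- Let d = ⌊n/7⌋ and t = 2d+1. A bit vector β on the middle positions [t, 2t) determines the input
-- family β: position p has class p mod t and value 2·class + bit, the bit being 1 on [0, t), β on
-- [t, 2t) and 0 beyond. An increasing subsequence meets a class twice only through an ascent, a
-- 0-bit followed by a later 1-bit of the same class, so without ascents the LIS is at most t.
-- Moving a middle position w into the class of another middle position i, with a suitable bit,
-- gives an input whose only possible ascent is (i, w); it occurs for exactly one value of the bit
-- of i, and then the left positions below the class, i, w and the right positions above it form
-- an increasing subsequence of length t + 1. Hence flipping the bit of i changes the LIS.
-- So every computation on family β queries at least d middle positions (two unqueried ones could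
-- be paired and flipped unnoticed), and we cut it just before its (d+1)-st middle query. If two
-- inputs of the family reach the same cut node after both querying a middle i with different
-- bits, the read-once property lets us splice them into two paired inputs with the same output
-- but different LIS. Branching on the bit of each queried middle position therefore reaches 2^d
-- distinct cut nodes, and 2^n ≤ 2^(8d) ≤ s^8.

open import Data.Bool using (Bool; true; false; not)
import Data.Bool as Bool
open import Data.Bool.Properties using (¬-not)
open import Data.Empty using (⊥; ⊥-elim)
open import Data.Fin using (Fin; toℕ; fromℕ<)
import Data.Fin as Fin
open import Data.Fin.Properties
  using (pigeonhole; toℕ-fromℕ<; toℕ-injective; toℕ<n; any?; injective⇒≤)
open import Data.List using (List; []; _∷_; _++_; length; lookup)
open import Data.List.Membership.Propositional using (_∈_; _∉_)
open import Data.List.Membership.Propositional.Properties using (∈-++⁺ˡ; ∈-++⁺ʳ; ∈-lookup)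
open import Data.List.Properties using (++-assoc; length-++)
open import Data.List.Relation.Binary.Subset.Propositional using (_⊆_)
open import Data.List.Relation.Unary.All using (All; []; _∷_)
import Data.List.Relation.Unary.All as All
import Data.List.Relation.Unary.All.Properties as All
open import Data.List.Relation.Unary.AllPairs using ([]; _∷_)
open import Data.List.Relation.Unary.Any using (here; there; index)
open import Data.List.Relation.Unary.Any.Properties using (lookup-index)
open import Data.List.Relation.Unary.Unique.Propositional using (Unique)
import Data.List.Relation.Unary.Unique.Propositional.Properties as Unique
open import Data.Nat
  using (ℕ; zero; suc; _+_; _*_; _∸_; _^_; _%_; _/_; _≤_; _<_; z≤n; s≤s; _≤?_; _<?_; NonZero)
open import Data.Nat.DivMod
  using (_mod_; m<n⇒m%n≡m; [m+kn]%n≡m%n; m≡m%n+[m/n]*n; m%n<n; m/n*n≤m; /-mono-≤)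
open import Data.Nat.Properties
open import Data.Nat.Tactic.RingSolver using (solve-∀)
open import Data.Product using (Σ; _×_; _,_; proj₁; proj₂; ∃-syntax)
open import Data.Sum using (_⊎_; inj₁; inj₂)
open import Data.Vec.Functional using (updateAt)
open import Data.Vec.Functional.Properties using (updateAt-updates; updateAt-minimal)
open import Function using (const; _∘_)
open import Level using (0ℓ)
open import Relation.Binary using (Tri; tri<; tri≈; tri>)
open import Relation.Binary.PropositionalEquality
  using (_≡_; _≢_; refl; sym; trans; cong; cong₂; subst; subst₂; module ≡-Reasoning)
open import Relation.Nullary using (¬_; yes; no; does; _×-dec_)
open import Relation.Nullary.Decidable using (dec-true; dec-false; ¬?; decidable-stable)
open import Relation.Unary using (Pred; Decidable)

open import Defs

Unique-++⇒∉ : ∀ {A : Set} (xs : List A) {ys : List A} {a : A} →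
              Unique (xs ++ ys) → a ∈ xs → a ∉ ys
Unique-++⇒∉ (x ∷ xs) (x∉ ∷ _) (here refl) a∈ys = All.lookup x∉ (∈-++⁺ʳ xs a∈ys) refl
Unique-++⇒∉ (x ∷ xs) (_ ∷ u) (there a∈xs) = Unique-++⇒∉ xs u a∈xs

Unique⇒lookup-injective : ∀ {A : Set} {xs : List A} → Unique xs →
                          ∀ {a b} → toℕ a < toℕ b → lookup xs a ≢ lookup xs b
Unique⇒lookup-injective (x∉ ∷ _) {Fin.zero} {Fin.suc b} _ = All.lookup x∉ (∈-lookup b)
Unique⇒lookup-injective (_ ∷ u) {Fin.suc a} {Fin.suc b} (s≤s a<b) = Unique⇒lookup-injective u a<b

Unique⇒length≤ : ∀ {s} {xs : List (Fin s)} → Unique xs → length xs ≤ s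
Unique⇒length≤ {s} {xs} u with length xs ≤? s
... | yes ≤s = ≤s
... | no ≰s with pigeonhole (≰⇒> ≰s) (lookup xs)
...   | a , b , a<b , eq = ⊥-elim (Unique⇒lookup-injective u a<b eq)

module Computation {n m s : ℕ} (P : BP n m s) where

  sink≢query : ∀ {u v i e} → node P u ≡ sink v → node P u ≢ query i e
  sink≢query eq eq′ with trans (sym eq) eq′
  ... | ()

  run-deterministic : ∀ {x u qs qs′ o o′} → Run P x u qs o → Run P x u qs′ o′ →
                      qs ≡ qs′ × o ≡ o′
  run-deterministic (at-sink eq) (at-sink eq′) with trans (sym eq) eq′
  ... | refl = refl , refl
  run-deterministic (at-sink eq) (step eq′ _) = ⊥-elim (sink≢query eq eq′)
  run-deterministic (step eq _) (at-sink eq′) = ⊥-elim (sink≢query eq′ eq)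
  run-deterministic (step eq r) (step eq′ r′) with trans (sym eq) eq′
  ... | refl with run-deterministic r r′
  ...   | refl , refl = refl , refl

  run-cong : ∀ {x y u qs o} → (∀ q → q ∈ qs → y q ≡ x q) →
             Run P x u qs o → Run P y u qs o
  run-cong agree (at-sink eq) = at-sink eq
  run-cong {x} {y} agree (step {i = i} {e} {qs} {o} eq r) =
    step eq (subst (λ a → Run P y (e a) qs o) (sym (agree i (here refl)))
                   (run-cong (λ q q∈ → agree q (there q∈)) r))

  output-is-LIS : ComputesLIS P → ∀ {x qs o} → Run P x (root P) qs o → IsLIS x o
  output-is-LIS computes {x} r with computes x
  ... | _ , _ , r′ , lis with run-deterministic r r′
  ...   | refl , refl = lis

  module Cuts (M : Pred (Fin n) 0ℓ) (M? : Decidable M) where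

    data Stop (u : Fin s) : Set where
      sink-stop   : ∀ {v} → node P u ≡ sink v → Stop u
      marked-stop : ∀ {i e} → node P u ≡ query i e → M i → Stop u

    -- Cut x u k v I: the computation on x from u queries I, which contains exactly k marked
    -- indices, and v is the first sink or marked query reached after the k-th of them
    -- (from u on, if k = 0).
    data Cut (x : Input n m) : Fin s → ℕ → Fin s → List (Fin n) → Set where
      stop     : ∀ {u} → Stop u → Cut x u 0 u []
      marked   : ∀ {u i e k v I} → node P u ≡ query i e → M i →
                 Cut x (e (x i)) k v I → Cut x u (suc k) v (i ∷ I)
      unmarked : ∀ {u i e k v I} → node P u ≡ query i e → ¬ M i →
                 Cut x (e (x i)) k v I → Cut x u k v (i ∷ I)

    MarkedIn : List (Fin n) → List (Fin n) → Set
    MarkedIn I ms = ∀ q → q ∈ I → M q → q ∈ ms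

    stop-unmarked : ∀ {u i e} → Stop u → node P u ≡ query i e → ¬ M i → ⊥
    stop-unmarked (sink-stop eq) eq′ _ = sink≢query eq eq′
    stop-unmarked (marked-stop eq mi) eq′ ¬mi with trans (sym eq) eq′
    ... | refl = ¬mi mi

    cut-cong : ∀ {x y u k v I} → (∀ q → q ∈ I → y q ≡ x q) →
               Cut x u k v I → Cut y u k v I
    cut-cong agree (stop st) = stop st
    cut-cong {x} {y} agree (marked {i = i} {e} {k} {v} {I} eq mi c) =
      marked eq mi (subst (λ a → Cut y (e a) k v I) (sym (agree i (here refl)))
                          (cut-cong (λ q q∈ → agree q (there q∈)) c))
    cut-cong {x} {y} agree (unmarked {i = i} {e} {k} {v} {I} eq ¬mi c) =
      unmarked eq ¬mi (subst (λ a → Cut y (e a) k v I) (sym (agree i (here refl)))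
                             (cut-cong (λ q q∈ → agree q (there q∈)) c))

    cut-run : ∀ {x u k v I R o} → Cut x u k v I → Run P x v R o → Run P x u (I ++ R) o
    cut-run (stop _) r = r
    cut-run (marked eq _ c) r = step eq (cut-run c r)
    cut-run (unmarked eq _ c) r = step eq (cut-run c r)

    run-through-cut : ∀ {x u k v I L o} → Cut x u k v I → Run P x u L o →
                      ∃[ R ] Run P x v R o × L ≡ I ++ R
    run-through-cut (stop _) r = _ , r , refl
    run-through-cut (marked eq _ _) (at-sink eq′) = ⊥-elim (sink≢query eq′ eq)
    run-through-cut (unmarked eq _ _) (at-sink eq′) = ⊥-elim (sink≢query eq′ eq)
    run-through-cut (marked eq _ c) (step eq′ r) with trans (sym eq) eq′
    ... | refl with run-through-cut c r
    ...   | R , r′ , refl = R , r′ , refl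
    run-through-cut (unmarked eq _ c) (step eq′ r) with trans (sym eq) eq′
    ... | refl with run-through-cut c r
    ...   | R , r′ , refl = R , r′ , refl

    cut-marked : ∀ {x u k v I} → Cut x u k v I → ∃[ ms ] length ms ≡ k × MarkedIn I ms
    cut-marked (stop _) = [] , refl , λ _ ()
    cut-marked (marked {i = i} _ _ c) with cut-marked c
    ... | ms , refl , within = i ∷ ms , refl , λ where
      q (here refl) _ → here refl
      q (there q∈) mq → there (within q q∈ mq)
    cut-marked (unmarked _ ¬mi c) with cut-marked c
    ... | ms , refl , within = ms , refl , λ where
      q (here refl) mq → ⊥-elim (¬mi mq)
      q (there q∈) mq → within q q∈ mq

    cut-or-few-marked : ∀ {x u L o} → Run P x u L o → ∀ k →
                        (∃[ v ] ∃[ I ] Cut x u k v I) ⊎ (∃[ ms ] length ms < k × MarkedIn L ms)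
    cut-or-few-marked (at-sink eq) zero = inj₁ (_ , [] , stop (sink-stop eq))
    cut-or-few-marked (at-sink eq) (suc k) = inj₂ ([] , s≤s z≤n , λ _ ())
    cut-or-few-marked (step {i = i} eq r) k with M? i
    cut-or-few-marked (step eq r) zero | yes mi = inj₁ (_ , [] , stop (marked-stop eq mi))
    cut-or-few-marked (step {i = i} eq r) (suc k) | yes mi with cut-or-few-marked r k
    ... | inj₁ (v , I , c) = inj₁ (v , i ∷ I , marked eq mi c)
    ... | inj₂ (ms , few , within) = inj₂ (i ∷ ms , s≤s few , λ where
      q (here refl) _ → here refl
      q (there q∈) mq → there (within q q∈ mq))
    cut-or-few-marked (step {i = i} eq r) k | no ¬mi with cut-or-few-marked r k
    ... | inj₁ (v , I , c) = inj₁ (v , i ∷ I , unmarked eq ¬mi c)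
    ... | inj₂ (ms , few , within) = inj₂ (ms , few , λ where
      q (here refl) mq → ⊥-elim (¬mi mq)
      q (there q∈) mq → within q q∈ mq)

    cut-extend : ∀ {x u j v v′ I I′} → Cut x u j v I → Cut x u (suc j) v′ I′ →
                 ∃[ i ] ∃[ e ] ∃[ N ] node P v ≡ query i e × M i × I′ ≡ I ++ i ∷ N
    cut-extend (stop (sink-stop eq)) (marked eq′ _ _) = ⊥-elim (sink≢query eq eq′)
    cut-extend (stop (sink-stop eq)) (unmarked eq′ _ _) = ⊥-elim (sink≢query eq eq′)
    cut-extend (stop (marked-stop eq mi)) (marked eq′ _ _) with trans (sym eq) eq′
    ... | refl = _ , _ , _ , eq , mi , refl
    cut-extend (stop st) (unmarked eq′ ¬mi _) = ⊥-elim (stop-unmarked st eq′ ¬mi)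
    cut-extend (marked eq mi c) (marked eq′ _ c′) with trans (sym eq) eq′
    ... | refl with cut-extend c c′
    ...   | i , e , N , eq″ , mi′ , refl = i , e , N , eq″ , mi′ , refl
    cut-extend (marked eq mi _) (unmarked eq′ ¬mi _) with trans (sym eq) eq′
    ... | refl = ⊥-elim (¬mi mi)
    cut-extend (unmarked eq ¬mi _) (marked eq′ mi _) with trans (sym eq) eq′
    ... | refl = ⊥-elim (¬mi mi)
    cut-extend (unmarked eq _ c) (unmarked eq′ _ c′) with trans (sym eq) eq′
    ... | refl with cut-extend c c′
    ...   | i , e , N , eq″ , mi′ , refl = i , e , N , eq″ , mi′ , refl

    rectangle : ReadOnce P → ∀ {x y k k′ v I J qs o} →
                Cut x (root P) k v I → Cut y (root P) k′ v J →
                (∀ q → q ∉ I → y q ≡ x q) →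
                Run P x (root P) qs o → ∃[ qs′ ] Run P y (root P) qs′ o
    -- Read-once: after v the run of x avoids I, so y, which agrees with x off I, follows it.
    rectangle read-once {x} {y} {I = I} cx cy agree r with run-through-cut cx r
    ... | R , r′ , refl = _ , cut-run cy (run-cong agree-on-R r′)
      where
      agree-on-R : ∀ q → q ∈ R → y q ≡ x q
      agree-on-R q q∈R = agree q (λ q∈I → Unique-++⇒∉ I (read-once _ _ _ r) q∈I q∈R)

LIS-separates : ∀ {n m t} {x y : Input n m} {o} →
                IncSub x (suc t) → (∀ k → IncSub y k → k ≤ t) → IsLIS x o → IsLIS y o → ⊥
LIS-separates long short (_ , longest) (inc , _) = ≤⇒≯ (short _ inc) (longest _ long)

bitValue : Bool → ℕ
bitValue false = 0
bitValue true  = 1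

bitValue≤1 : ∀ b → bitValue b ≤ 1
bitValue≤1 false = z≤n
bitValue≤1 true  = s≤s z≤n

bitValue-< : ∀ {a b} → bitValue a < bitValue b → a ≡ false × b ≡ true
bitValue-< {false} {true} _ = refl , refl
bitValue-< {true} {true} (s≤s ())

r+2a<r′+2b : ∀ {a b} r r′ → a < b → r ≤ 1 → r + 2 * a < r′ + 2 * b
r+2a<r′+2b {a} {b} r r′ a<b r≤1 = begin-strict
  r + 2 * a          ≤⟨ +-monoˡ-≤ (2 * a) r≤1 ⟩
  suc (2 * a)        <⟨ n<1+n _ ⟩
  suc (suc (2 * a))  ≡⟨ *-suc 2 a ⟨
  2 * suc a          ≤⟨ *-monoʳ-≤ 2 a<b ⟩
  2 * b              ≤⟨ m≤n+m (2 * b) r′ ⟩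
  r′ + 2 * b         ∎
  where open ≤-Reasoning

module Encoding {n m t : ℕ} (2t≤m : 2 * t ≤ m) where

  symbol : Fin t → Bool → Fin m
  symbol c b = fromℕ< (<-≤-trans (r+2a<r′+2b (bitValue b) 0 (toℕ<n c) (bitValue≤1 b)) 2t≤m)

  toℕ-symbol : ∀ c b → toℕ (symbol c b) ≡ bitValue b + 2 * toℕ c
  toℕ-symbol c b = toℕ-fromℕ< _

  encode : (Fin n → Fin t) → (Fin n → Bool) → Input n m
  encode C B q = symbol (C q) (B q)

  Ascent : (Fin n → Fin t) → (Fin n → Bool) → Fin n → Fin n → Set
  Ascent C B a b = toℕ a < toℕ b × C a ≡ C b × B a ≡ false × B b ≡ true

  same-class-increase : ∀ {c b b′} → toℕ (symbol c b) < toℕ (symbol c b′) →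
                        b ≡ false × b′ ≡ true
  same-class-increase {c} {b} {b′} increase = bitValue-< (+-cancelʳ-< (2 * toℕ c) _ _
    (subst₂ _<_ (toℕ-symbol c b) (toℕ-symbol c b′) increase))

  ascent-free⇒LIS≤ : ∀ {C B} → (∀ a b → ¬ Ascent C B a b) →
                     ∀ k → IncSub (encode C B) k → k ≤ t
  ascent-free⇒LIS≤ {C} {B} free k (f , increasing) with k ≤? t
  ... | yes k≤t = k≤t
  ... | no k≰t with pigeonhole (≰⇒> k≰t) (λ a → C (f a))
  ...   | a , b , a<b , same with increasing a b a<b
  ...     | positions< , values< rewrite same =
    ⊥-elim (free (f a) (f b) (positions< , same , same-class-increase {C (f b)} values<))

module LongChain {n m : ℕ} (t : ℕ) (3t≤n : t + t + t ≤ n) (x : Input n m)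
  (left  : ∀ q → toℕ q < t → toℕ (x q) ≡ 1 + 2 * toℕ q)
  (right : ∀ q j → j < t → toℕ q ≡ t + t + j → toℕ (x q) ≡ 2 * j)
  {c : ℕ} (c<t : c < t)
  {A B : Fin n} (t≤A : t ≤ toℕ A) (A<B : toℕ A < toℕ B) (B<2t : toℕ B < t + t)
  (xA : toℕ (x A) ≡ 2 * c) (xB : toℕ (x B) ≡ 1 + 2 * c) where

  data Slot (k : ℕ) : Set where
    before : k < c → Slot k
    first  : k ≡ c → Slot k
    second : k ≡ suc c → Slot k
    after  : ∀ d → k ≡ suc (suc (c + d)) → Slot k

  slot : ∀ k → Slot k
  slot k with <-cmp k c
  ... | tri< k<c _ _ = before k<c
  ... | tri≈ _ k≡c _ = first k≡c
  ... | tri> _ _ c<k with m≤n⇒m<n∨m≡n c<k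
  ...   | inj₁ 1+c<k = after (k ∸ suc (suc c)) (sym (m+[n∸m]≡n 1+c<k))
  ...   | inj₂ 1+c≡k = second (sym 1+c≡k)

  position : ∀ {k} → Slot k → ℕ
  position {k} (before _) = k
  position (first _)      = toℕ A
  position (second _)     = toℕ B
  position (after d _)    = t + t + suc (c + d)

  value : ∀ {k} → Slot k → ℕ
  value {k} (before _) = 1 + 2 * k
  value (first _)      = 2 * c
  value (second _)     = 1 + 2 * c
  value (after d _)    = 2 * suc (c + d)

  after<t : ∀ {k d} → k ≤ t → k ≡ suc (suc (c + d)) → suc (c + d) < t
  after<t k≤t refl = k≤t

  2t≤n : t + t ≤ n
  2t≤n = ≤-trans (m≤m+n (t + t) t) 3t≤n

  position<n : ∀ {k} → k ≤ t → (σ : Slot k) → position σ < n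
  position<n _ (before k<c)   = <-≤-trans (<-trans k<c c<t) (≤-trans (m≤m+n t t) 2t≤n)
  position<n _ (first _)      = <-≤-trans (<-trans A<B B<2t) 2t≤n
  position<n _ (second _)     = <-≤-trans B<2t 2t≤n
  position<n k≤t (after d k≡) = <-≤-trans (+-monoʳ-< (t + t) (after<t k≤t k≡)) 3t≤n

  value-at : ∀ {k} → k ≤ t → (σ : Slot k) → (q : Fin n) →
             toℕ q ≡ position σ → toℕ (x q) ≡ value σ
  value-at _ (before k<c) q refl = left q (<-trans k<c c<t)
  value-at _ (first _) q eq rewrite toℕ-injective {i = q} {A} eq = xA
  value-at _ (second _) q eq rewrite toℕ-injective {i = q} {B} eq = xB
  value-at k≤t (after d k≡) q eq = right q (suc (c + d)) (after<t k≤t k≡) eq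

  t≤after : ∀ d → t ≤ t + t + d
  t≤after d = ≤-trans (m≤m+n t t) (m≤m+n (t + t) d)

  slot-increasing : ∀ {k k′} → k < k′ → (σ : Slot k) (σ′ : Slot k′) →
                    position σ < position σ′ × value σ < value σ′
  slot-increasing k<k′ (before _) (before _) = k<k′ , r+2a<r′+2b 1 1 k<k′ (s≤s z≤n)
  slot-increasing _ (before k<c) (first _) =
    <-≤-trans (<-trans k<c c<t) t≤A , r+2a<r′+2b 1 0 k<c (s≤s z≤n)
  slot-increasing _ (before k<c) (second _) =
    <-trans (<-≤-trans (<-trans k<c c<t) t≤A) A<B , r+2a<r′+2b 1 1 k<c (s≤s z≤n)
  slot-increasing _ (before k<c) (after d _) =
    <-≤-trans (<-trans k<c c<t) (t≤after _) ,
    r+2a<r′+2b 1 0 (≤-trans k<c (≤-trans (m≤m+n c d) (n≤1+n _))) (s≤s z≤n)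
  slot-increasing k<k′ (first refl) (before k′<c) = ⊥-elim (<-asym k<k′ k′<c)
  slot-increasing k<k′ (first refl) (first refl) = ⊥-elim (<-irrefl refl k<k′)
  slot-increasing _ (first _) (second _) = A<B , n<1+n _
  slot-increasing _ (first _) (after d _) =
    <-≤-trans (<-trans A<B B<2t) (m≤m+n (t + t) _) , r+2a<r′+2b 0 0 (s≤s (m≤m+n c d)) z≤n
  slot-increasing k<k′ (second refl) (before k′<c) =
    ⊥-elim (<-asym (<-trans (n<1+n _) k<k′) k′<c)
  slot-increasing k<k′ (second refl) (first refl) = ⊥-elim (<-asym k<k′ (n<1+n _))
  slot-increasing k<k′ (second refl) (second refl) = ⊥-elim (<-irrefl refl k<k′)
  slot-increasing _ (second _) (after d _) =
    <-≤-trans B<2t (m≤m+n (t + t) _) , r+2a<r′+2b 1 0 (s≤s (m≤m+n c d)) (s≤s z≤n)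
  slot-increasing k<k′ (after d refl) (before k′<c) =
    ⊥-elim (<-asym (<-trans (s≤s (≤-trans (m≤m+n c d) (n≤1+n _))) k<k′) k′<c)
  slot-increasing k<k′ (after d refl) (first refl) =
    ⊥-elim (<⇒≱ k<k′ (≤-trans (m≤m+n c d) (≤-trans (n≤1+n _) (n≤1+n _))))
  slot-increasing k<k′ (after d refl) (second refl) =
    ⊥-elim (<⇒≱ k<k′ (s≤s (≤-trans (m≤m+n c d) (n≤1+n _))))
  slot-increasing (s≤s (s≤s c+d<c+d′)) (after d refl) (after d′ refl) =
    +-monoʳ-< (t + t) (s≤s c+d<c+d′) , r+2a<r′+2b 0 0 (s≤s c+d<c+d′) z≤n

  chain : IncSub x (suc t)
  chain = element , increasing
    where
    index≤t : (a : Fin (suc t)) → toℕ a ≤ t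
    index≤t a = ≤-pred (toℕ<n a)
    element : Fin (suc t) → Fin n
    element a = fromℕ< (position<n (index≤t a) (slot (toℕ a)))
    toℕ-element : ∀ a → toℕ (element a) ≡ position (slot (toℕ a))
    toℕ-element a = toℕ-fromℕ< _
    value-element : ∀ a → toℕ (x (element a)) ≡ value (slot (toℕ a))
    value-element a = value-at (index≤t a) (slot (toℕ a)) (element a) (toℕ-element a)
    increasing : ∀ a b → toℕ a < toℕ b →
                 toℕ (element a) < toℕ (element b) × toℕ (x (element a)) < toℕ (x (element b))
    increasing a b a<b with slot-increasing a<b (slot (toℕ a)) (slot (toℕ b))
    ... | positions< , values< = subst₂ _<_ (sym (toℕ-element a)) (sym (toℕ-element b)) positions< ,
                                 subst₂ _<_ (sym (value-element a)) (sym (value-element b)) values<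

module Layout {n m : ℕ} (t : ℕ) .{{_ : NonZero t}} (3t≤n : t + t + t ≤ n) (n<m : n < m) where

  2*t≡t+t : 2 * t ≡ t + t
  2*t≡t+t = cong (t +_) (+-identityʳ t)

  2t≤m : 2 * t ≤ m
  2t≤m = begin
    2 * t     ≡⟨ 2*t≡t+t ⟩
    t + t     ≤⟨ m≤m+n (t + t) t ⟩
    t + t + t ≤⟨ 3t≤n ⟩
    n         <⟨ n<m ⟩
    m         ∎
    where open ≤-Reasoning

  open Encoding {n} {m} {t} 2t≤m public
  open import Data.List.Membership.DecPropositional (Fin._≟_ {n}) using (_∈?_)

  Middle : Pred (Fin n) 0ℓ
  Middle q = t ≤ toℕ q × toℕ q < t + t

  middle? : Decidable Middle
  middle? q = t ≤? toℕ q ×-dec toℕ q <? t + t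

  class : Fin n → Fin t
  class q = toℕ q mod t

  class-offset : ∀ q j k → j < t → toℕ q ≡ j + k * t → toℕ (class q) ≡ j
  class-offset q j k j<t eq = begin
    toℕ (class q)   ≡⟨ toℕ-fromℕ< _ ⟩
    toℕ q % t       ≡⟨ cong (_% t) eq ⟩
    (j + k * t) % t ≡⟨ [m+kn]%n≡m%n j k t ⟩
    j % t           ≡⟨ m<n⇒m%n≡m j<t ⟩
    j               ∎
    where open ≡-Reasoning

  class-left : ∀ q → toℕ q < t → toℕ (class q) ≡ toℕ q
  class-left q q<t = class-offset q (toℕ q) 0 q<t (sym (+-identityʳ (toℕ q)))

  class-right : ∀ q j → j < t → toℕ q ≡ t + t + j → toℕ (class q) ≡ j
  class-right q j j<t eq =
    class-offset q j 2 j<t (trans eq (trans (+-comm (t + t) j) (cong (j +_) (sym 2*t≡t+t))))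

  class-middle : ∀ {q} → Middle q → toℕ (class q) ≡ toℕ q ∸ t
  class-middle {q} (t≤q , q<2t) = class-offset q (toℕ q ∸ t) 1 offset<t
    (trans (sym (m∸n+n≡m t≤q)) (cong (toℕ q ∸ t +_) (sym (+-identityʳ t))))
    where
    offset<t : toℕ q ∸ t < t
    offset<t = +-cancelʳ-< t (toℕ q ∸ t) t (subst (_< t + t) (sym (m∸n+n≡m t≤q)) q<2t)

  class-middle-injective : ∀ {a b} → Middle a → Middle b → class a ≡ class b → a ≡ b
  class-middle-injective ma@(t≤a , _) mb@(t≤b , _) same =
    toℕ-injective (∸-cancelʳ-≡ t≤a t≤b
      (trans (sym (class-middle ma)) (trans (cong toℕ same) (class-middle mb))))

  bits : (Fin n → Bool) → Fin n → Bool
  bits β q with toℕ q <? t | toℕ q <? t + t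
  ... | yes _ | _     = true
  ... | no _  | yes _ = β q
  ... | no _  | no _  = false

  bits-left : ∀ β q → toℕ q < t → bits β q ≡ true
  bits-left β q q<t with toℕ q <? t | toℕ q <? t + t
  ... | yes _   | _ = refl
  ... | no q≮t  | _ = ⊥-elim (q≮t q<t)

  bits-middle : ∀ β {q} → Middle q → bits β q ≡ β q
  bits-middle β {q} (t≤q , q<2t) with toℕ q <? t | toℕ q <? t + t
  ... | yes q<t | _       = ⊥-elim (<⇒≱ q<t t≤q)
  ... | no _    | yes _   = refl
  ... | no _    | no q≮2t = ⊥-elim (q≮2t q<2t)

  bits-right : ∀ β q → t + t ≤ toℕ q → bits β q ≡ false
  bits-right β q 2t≤q with toℕ q <? t | toℕ q <? t + t
  ... | yes q<t | _       = ⊥-elim (<⇒≱ q<t (≤-trans (m≤m+n t t) 2t≤q))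
  ... | no _    | yes q<2t = ⊥-elim (<⇒≱ q<2t 2t≤q)
  ... | no _    | no _    = refl

  bits-true : ∀ β q → bits β q ≡ true → toℕ q < t + t
  bits-true β q _ with toℕ q <? t | toℕ q <? t + t
  ... | yes q<t | _        = <-≤-trans q<t (m≤m+n t t)
  ... | no _    | yes q<2t = q<2t

  bits-false : ∀ β q → bits β q ≡ false → t ≤ toℕ q
  bits-false β q _ with toℕ q <? t | toℕ q <? t + t
  ... | no q≮t | _ = ≮⇒≥ q≮t

  bits-cong : ∀ {β β′} q → β q ≡ β′ q → bits β q ≡ bits β′ q
  bits-cong q eq with toℕ q <? t | toℕ q <? t + t
  ... | yes _ | _     = refl
  ... | no _  | yes _ = eq
  ... | no _  | no _  = refl

  family : (Fin n → Bool) → Input n m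
  family β = encode class (bits β)

  family-cong : ∀ {β β′} q → β q ≡ β′ q → family β q ≡ family β′ q
  family-cong q eq = cong (symbol (class q)) (bits-cong q eq)

  pairedClass : Fin n → Fin n → Fin n → Fin t
  pairedClass i w = updateAt class w (const (class i))

  -- The bit of w makes i and w an ascent exactly when the bit of i differs from it.
  pairedBits : Fin n → Fin n → (Fin n → Bool) → Fin n → Bool
  pairedBits i w β = updateAt (bits β) w (const (does (toℕ i <? toℕ w)))

  paired : Fin n → Fin n → (Fin n → Bool) → Input n m
  paired i w β = encode (pairedClass i w) (pairedBits i w β)

  paired-off-w : ∀ i w β q → q ≢ w → paired i w β q ≡ family β q
  paired-off-w i w β q q≢w =
    cong₂ symbol (updateAt-minimal q w class q≢w) (updateAt-minimal q w (bits β) q≢w)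

  paired-cong : ∀ i w {β β′} q → β q ≡ β′ q → paired i w β q ≡ paired i w β′ q
  paired-cong i w {β} {β′} q eq with q Fin.≟ w
  ... | yes refl = cong (symbol (pairedClass i q q))
                     (trans (updateAt-updates q (bits β)) (sym (updateAt-updates q (bits β′))))
  ... | no q≢w   =
    trans (paired-off-w i w β q q≢w) (trans (family-cong q eq) (sym (paired-off-w i w β′ q q≢w)))

  value-outside-middle : ∀ i {w} β q → Middle w → ¬ Middle q →
                         toℕ (paired i w β q) ≡ bitValue (bits β q) + 2 * toℕ (class q)
  value-outside-middle i β q mw ¬mq =
    trans (cong toℕ (paired-off-w i _ β q λ { refl → ¬mq mw })) (toℕ-symbol (class q) (bits β q))

  paired-left : ∀ i {w} β → Middle w → ∀ q → toℕ q < t → toℕ (paired i w β q) ≡ 1 + 2 * toℕ q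
  paired-left i β mw q q<t = begin
    toℕ (paired i _ β q)                    ≡⟨ value-outside-middle i β q mw
                                                 (λ (t≤q , _) → <⇒≱ q<t t≤q) ⟩
    bitValue (bits β q) + 2 * toℕ (class q) ≡⟨ cong₂ (λ b c → bitValue b + 2 * c)
                                                     (bits-left β q q<t) (class-left q q<t) ⟩
    1 + 2 * toℕ q                           ∎
    where open ≡-Reasoning

  paired-right : ∀ i {w} β → Middle w → ∀ q j → j < t → toℕ q ≡ t + t + j →
                 toℕ (paired i w β q) ≡ 2 * j
  paired-right i β mw q j j<t eq = begin
    toℕ (paired i _ β q)                    ≡⟨ value-outside-middle i β q mw
                                                 (λ (_ , q<2t) → <⇒≱ q<2t 2t≤q) ⟩
    bitValue (bits β q) + 2 * toℕ (class q) ≡⟨ cong₂ (λ b c → bitValue b + 2 * c)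
                                                     (bits-right β q 2t≤q) (class-right q j j<t eq) ⟩
    2 * j                                   ∎
    where
    open ≡-Reasoning
    2t≤q : t + t ≤ toℕ q
    2t≤q = subst (t + t ≤_) (sym eq) (m≤m+n (t + t) j)

  paired-at-i : ∀ {i w} β → Middle i → i ≢ w →
                toℕ (paired i w β i) ≡ bitValue (β i) + 2 * toℕ (class i)
  paired-at-i {i} β mi i≢w = begin
    toℕ (paired i _ β i)                    ≡⟨ cong toℕ (paired-off-w i _ β i i≢w) ⟩
    toℕ (family β i)                        ≡⟨ toℕ-symbol (class i) (bits β i) ⟩
    bitValue (bits β i) + 2 * toℕ (class i) ≡⟨ cong (λ b → bitValue b + 2 * toℕ (class i))
                                                   (bits-middle β mi) ⟩
    bitValue (β i) + 2 * toℕ (class i)      ∎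
    where open ≡-Reasoning

  paired-at-w : ∀ i w β → toℕ (paired i w β w) ≡ bitValue (does (toℕ i <? toℕ w)) + 2 * toℕ (class i)
  paired-at-w i w β = trans (toℕ-symbol (pairedClass i w w) (pairedBits i w β w))
    (cong₂ (λ b c → bitValue b + 2 * toℕ c) (updateAt-updates w (bits β)) (updateAt-updates w class))

  paired-long : ∀ {i w β} → Middle i → Middle w → i ≢ w → β i ≢ does (toℕ i <? toℕ w) →
                IncSub (paired i w β) (suc t)
  paired-long {i} {w} {β} mi mw i≢w flipped = by-order (<-cmp (toℕ i) (toℕ w))
    where
    c : ℕ
    c = toℕ (class i)
    chain : ∀ {A B} → t ≤ toℕ A → toℕ A < toℕ B → toℕ B < t + t →
            toℕ (paired i w β A) ≡ 2 * c → toℕ (paired i w β B) ≡ 1 + 2 * c →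
            IncSub (paired i w β) (suc t)
    chain = LongChain.chain t 3t≤n (paired i w β) (paired-left i β mw) (paired-right i β mw) (toℕ<n (class i))
    at-i : ∀ {b} → does (toℕ i <? toℕ w) ≡ b → toℕ (paired i w β i) ≡ bitValue (not b) + 2 * c
    at-i refl = trans (paired-at-i β mi i≢w) (cong (λ b → bitValue b + 2 * c) (¬-not flipped))
    at-w : ∀ {b} → does (toℕ i <? toℕ w) ≡ b → toℕ (paired i w β w) ≡ bitValue b + 2 * c
    at-w refl = paired-at-w i w β
    by-order : Tri (toℕ i < toℕ w) (toℕ i ≡ toℕ w) (toℕ w < toℕ i) → IncSub (paired i w β) (suc t)
    by-order (tri< i<w _ _) = chain (proj₁ mi) i<w (proj₂ mw) (at-i w-set) (at-w w-set)
      where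
      w-set : does (toℕ i <? toℕ w) ≡ true
      w-set = dec-true (toℕ i <? toℕ w) i<w
    by-order (tri≈ _ i≡w _) = ⊥-elim (i≢w (toℕ-injective i≡w))
    by-order (tri> _ _ w<i) = chain (proj₁ mw) w<i (proj₂ mi) (at-w w-unset) (at-i w-unset)
      where
      w-unset : does (toℕ i <? toℕ w) ≡ false
      w-unset = dec-false (toℕ i <? toℕ w) (<-asym w<i)

  pairedBits-false : ∀ i {w} β q → Middle w → pairedBits i w β q ≡ false → t ≤ toℕ q
  pairedBits-false i {w} β q mw eq with q Fin.≟ w
  ... | yes refl = proj₁ mw
  ... | no q≢w   = bits-false β q (trans (sym (updateAt-minimal q w (bits β) q≢w)) eq)

  pairedBits-true : ∀ i {w} β q → Middle w → pairedBits i w β q ≡ true → toℕ q < t + t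
  pairedBits-true i {w} β q mw eq with q Fin.≟ w
  ... | yes refl = proj₂ mw
  ... | no q≢w   = bits-true β q (trans (sym (updateAt-minimal q w (bits β) q≢w)) eq)

  paired-short : ∀ {i w β} → Middle i → Middle w → i ≢ w → β i ≡ does (toℕ i <? toℕ w) →
                 ∀ k → IncSub (paired i w β) k → k ≤ t
  paired-short {i} {w} {β} mi mw i≢w balanced = ascent-free⇒LIS≤ no-ascent
    where
    C : Fin n → Fin t
    C = pairedClass i w
    B : Fin n → Bool
    B = pairedBits i w β

    B-i≡B-w : B i ≡ B w
    B-i≡B-w = trans (updateAt-minimal i w (bits β) i≢w)
              (trans (bits-middle β mi) (trans balanced (sym (updateAt-updates w (bits β)))))

    C-off-w : ∀ {q} → q ≢ w → C q ≡ class q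
    C-off-w q≢w = updateAt-minimal _ w class q≢w

    ascent-in-middle : ∀ {a b} → toℕ a < toℕ b → B a ≡ false → B b ≡ true →
                       Middle a × Middle b
    ascent-in-middle {a} {b} a<b a-false b-true =
      (t≤a , <-trans a<b b<2t) , (≤-trans t≤a (<⇒≤ a<b) , b<2t)
      where
      t≤a : t ≤ toℕ a
      t≤a = pairedBits-false i β a mw a-false
      b<2t : toℕ b < t + t
      b<2t = pairedBits-true i β b mw b-true

    no-ascent : ∀ a b → ¬ Ascent C B a b
    no-ascent a b (a<b , same , a-false , b-true)
      with a Fin.≟ w | b Fin.≟ w | ascent-in-middle a<b a-false b-true
    ... | yes refl | yes refl | _ = <-irrefl refl a<b
    ... | no a≢w   | no b≢w   | ma , mb =
      <-irrefl (cong toℕ (class-middle-injective ma mb (trans (sym (C-off-w a≢w)) (trans same (C-off-w b≢w)))))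
               a<b
    ... | yes refl | no b≢w   | _ , mb
      with class-middle-injective mi mb (trans (sym (updateAt-updates w class)) (trans same (C-off-w b≢w)))
    ...   | refl with trans (sym b-true) (trans B-i≡B-w a-false)
    ...     | ()
    no-ascent a b (a<b , same , a-false , b-true) | no a≢w | yes refl | ma , _
      with class-middle-injective ma mi (trans (sym (C-off-w a≢w)) (trans same (updateAt-updates w class)))
    ...   | refl with trans (sym b-true) (trans (sym B-i≡B-w) a-false)
    ...     | ()

  paired-separates : ∀ {i w β β′ o} → Middle i → Middle w → i ≢ w → β i ≢ β′ i →
                     IsLIS (paired i w β) o → IsLIS (paired i w β′) o → ⊥
  paired-separates {i} {w} {β} {β′} mi mw i≢w differ lis lis′ with β i Bool.≟ does (toℕ i <? toℕ w)
  ... | yes balanced =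
    LIS-separates {x = paired i w β′} {y = paired i w β}
      (paired-long {β = β′} mi mw i≢w (λ e → differ (trans balanced (sym e))))
      (paired-short {β = β} mi mw i≢w balanced) lis′ lis
  ... | no flipped =
    LIS-separates {x = paired i w β} {y = paired i w β′}
      (paired-long {β = β} mi mw i≢w flipped) (paired-short {β = β′} mi mw i≢w flipped′) lis lis′
    where
    flipped′ : β′ i ≡ does (toℕ i <? toℕ w)
    flipped′ = trans (¬-not (differ ∘ sym)) (sym (¬-not (flipped ∘ sym)))

  t+j<n : ∀ (j : Fin t) → t + toℕ j < n
  t+j<n j = <-≤-trans (+-monoʳ-< t (toℕ<n j)) (≤-trans (m≤m+n (t + t) t) 3t≤n)

  middleAt : Fin t → Fin n
  middleAt j = fromℕ< (t+j<n j)

  middleAt-middle : ∀ j → Middle (middleAt j)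
  middleAt-middle j rewrite toℕ-fromℕ< (t+j<n j) = m≤m+n t (toℕ j) , +-monoʳ-< t (toℕ<n j)

  middleAt-injective : ∀ {j j′} → middleAt j ≡ middleAt j′ → j ≡ j′
  middleAt-injective {j} {j′} eq = toℕ-injective (+-cancelˡ-≡ t (toℕ j) (toℕ j′)
    (trans (sym (toℕ-fromℕ< (t+j<n j))) (trans (cong toℕ eq) (toℕ-fromℕ< (t+j<n j′)))))

  free-middle : ∀ ms → length ms < t → ∃[ q ] Middle q × q ∉ ms
  free-middle ms short with any? (λ j → ¬? (middleAt j ∈? ms))
  ... | yes (j , j∉ms) = middleAt j , middleAt-middle j , j∉ms
  ... | no none = ⊥-elim (<⇒≱ short (injective⇒≤ index-injective))
    where
    all-in : ∀ j → middleAt j ∈ ms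
    all-in j = decidable-stable (middleAt j ∈? ms) (λ j∉ms → none (j , j∉ms))
    index-injective : ∀ {j j′} → index (all-in j) ≡ index (all-in j′) → j ≡ j′
    index-injective {j} {j′} eq = middleAt-injective
      (trans (lookup-index (all-in j)) (trans (cong (lookup ms) eq) (sym (lookup-index (all-in j′)))))

module Fooling {n m s : ℕ} (t : ℕ) .{{_ : NonZero t}} (3t≤n : t + t + t ≤ n) (n<m : n < m)
               (P : BP n m s) (read-once : ReadOnce P) (computes : ComputesLIS P)
               (depth : ℕ) (2depth<t : depth + depth < t) where

  open Layout t 3t≤n n<m
  open Computation P
  open Cuts Middle middle?
  open import Data.List.Membership.DecPropositional (Fin._≟_ {n}) using (_∈?_)

  depth<t : depth < t
  depth<t = ≤-<-trans (m≤m+n depth depth) 2depth<t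

  unqueried-pair-impossible : ∀ {β qs o i w} → Run P (family β) (root P) qs o →
                              Middle i → Middle w → i ≢ w → i ∉ qs → w ∉ qs → ⊥
  unqueried-pair-impossible {β} {qs} {o} {i} {w} r mi mw i≢w i∉qs w∉qs =
    paired-separates {β = β[ true ]} {β[ false ]} mi mw i≢w differ (lis true) (lis false)
    where
    β[_] : Bool → Fin n → Bool
    β[ b ] = updateAt β i (const b)
    agrees : ∀ b q → q ∈ qs → paired i w β[ b ] q ≡ family β q
    agrees b q q∈qs = trans (paired-off-w i w β[ b ] q λ { refl → w∉qs q∈qs })
                            (family-cong q (updateAt-minimal q i β λ { refl → i∉qs q∈qs }))
    lis : ∀ b → IsLIS (paired i w β[ b ]) o
    lis b = output-is-LIS computes (run-cong (agrees b) r)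
    differ : β[ true ] i ≢ β[ false ] i
    differ eq with trans (sym (updateAt-updates i β)) (trans eq (updateAt-updates i β))
    ... | ()

  few-marked-impossible : ∀ {β qs o} → Run P (family β) (root P) qs o →
                          ∀ ms → length ms < depth → MarkedIn qs ms → ⊥
  few-marked-impossible {qs = qs} r ms few within with free-middle ms (<-trans few depth<t)
  ... | w , mw , w∉ms with free-middle (w ∷ ms) (≤-<-trans few depth<t)
  ...   | i , mi , i∉w∷ms =
    unqueried-pair-impossible r mi mw (i∉w∷ms ∘ here)
                              (unqueried mi (i∉w∷ms ∘ there)) (unqueried mw w∉ms)
    where
    unqueried : ∀ {q} → Middle q → q ∉ ms → q ∉ qs
    unqueried mq q∉ms q∈qs = q∉ms (within _ q∈qs mq)

  cut-at : ∀ β {j} → j ≤ depth → ∃[ v ] ∃[ I ] Cut (family β) (root P) j v I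
  cut-at β {j} j≤depth with computes (family β)
  ... | qs , o , r , _ with cut-or-few-marked r j
  ...   | inj₁ cut = cut
  ...   | inj₂ (ms , few , within) =
    ⊥-elim (few-marked-impossible r ms (<-≤-trans few j≤depth) within)

  cut-step : ∀ {β j u I} → j < depth → Cut (family β) (root P) j u I →
             ∃[ i ] ∃[ e ] node P u ≡ query i e × Middle i × i ∉ I ×
             ∃[ v ] ∃[ N ] Cut (family β) (root P) (suc j) v (I ++ i ∷ N)
  cut-step {β} {I = I} j<depth c with cut-at β j<depth
  ... | v , I′ , c′ with cut-extend c c′
  ...   | i , e , N , nq , mi , refl = i , e , nq , mi , fresh , v , N , c′
    where
    fresh : i ∉ I
    fresh i∈I with computes (family β)
    ... | _ , _ , r , _ with run-through-cut c′ r
    ...   | R , _ , refl =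
      Unique-++⇒∉ I (subst Unique (++-assoc I (i ∷ N) R) (read-once _ _ _ r)) i∈I (here refl)

  override : List (Fin n) → (Fin n → Bool) → (Fin n → Bool) → Fin n → Bool
  override L α γ q with q ∈? L
  ... | yes _ = α q
  ... | no _  = γ q

  override-∈ : ∀ {L} α γ {q} → q ∈ L → override L α γ q ≡ α q
  override-∈ {L} α γ {q} q∈L with q ∈? L
  ... | yes _   = refl
  ... | no q∉L  = ⊥-elim (q∉L q∈L)

  override-∉ : ∀ {L} α γ {q} → q ∉ L → override L α γ q ≡ γ q
  override-∉ {L} α γ {q} q∉L with q ∈? L
  ... | yes q∈L = ⊥-elim (q∉L q∈L)
  ... | no _    = refl

  separated-by : ∀ {β₁ β₂ v L₁ L₂ i w} →
                 Cut (family β₁) (root P) depth v L₁ → Cut (family β₂) (root P) depth v L₂ →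
                 Middle i → Middle w → i ∈ L₁ → i ∈ L₂ → w ∉ L₁ → w ∉ L₂ →
                 β₁ i ≢ β₂ i → ⊥
  separated-by {β₁} {β₂} {v} {L₁} {L₂} {i} {w} c₁ c₂ mi mw i∈L₁ i∈L₂ w∉L₁ w∉L₂ differ =
    conclude (computes z′)
    where
    i≢w : i ≢ w
    i≢w refl = w∉L₁ i∈L₁
    γ γ′ : Fin n → Bool
    γ = override L₁ β₁ β₂
    γ′ = override L₂ β₂ γ
    z z′ : Input n m
    z = paired i w γ
    z′ = paired i w γ′
    follows₁ : ∀ q → q ∈ L₁ → z q ≡ family β₁ q
    follows₁ q q∈ =
      trans (paired-off-w i w γ q λ { refl → w∉L₁ q∈ }) (family-cong q (override-∈ β₁ β₂ q∈))
    follows₂ : ∀ q → q ∈ L₂ → z′ q ≡ family β₂ q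
    follows₂ q q∈ =
      trans (paired-off-w i w γ′ q λ { refl → w∉L₂ q∈ }) (family-cong q (override-∈ β₂ γ q∈))
    agree-off-L₂ : ∀ q → q ∉ L₂ → z q ≡ z′ q
    agree-off-L₂ q q∉L₂ = paired-cong i w q (sym (override-∉ β₂ γ q∉L₂))
    differ′ : γ i ≢ γ′ i
    differ′ eq = differ (trans (sym (override-∈ β₁ β₂ i∈L₁)) (trans eq (override-∈ β₂ γ i∈L₂)))
    conclude : ∃[ qs ] ∃[ o ] Run P z′ (root P) qs o × IsLIS z′ o → ⊥
    conclude (_ , o , r′ , lis′) = paired-separates mi mw i≢w differ′ lis lis′
      where
      lis : IsLIS z o
      lis = output-is-LIS computes
        (proj₂ (rectangle read-once (cut-cong follows₂ c₂) (cut-cong follows₁ c₁) agree-off-L₂ r′))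

  cuts-separate : ∀ {β₁ β₂ v L₁ L₂ i} →
                  Cut (family β₁) (root P) depth v L₁ → Cut (family β₂) (root P) depth v L₂ →
                  Middle i → i ∈ L₁ → i ∈ L₂ → β₁ i ≢ β₂ i → ⊥
  cuts-separate c₁ c₂ mi i∈L₁ i∈L₂ differ with cut-marked c₁ | cut-marked c₂
  ... | ms₁ , len₁ , within₁ | ms₂ , len₂ , within₂
    with free-middle (ms₁ ++ ms₂)
                     (subst (_< t) (sym (trans (length-++ ms₁) (cong₂ _+_ len₁ len₂))) 2depth<t)
  ...   | w , mw , w∉ =
    separated-by c₁ c₂ mi mw i∈L₁ i∈L₂ (λ w∈ → w∉ (∈-++⁺ˡ (within₁ w w∈ mw)))
                 (λ w∈ → w∉ (∈-++⁺ʳ ms₁ (within₂ w w∈ mw))) differ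

  Witness : (Fin n → Bool) → List (Fin n) → Fin s → Set
  Witness β₀ I v =
    ∃[ β ] (∀ q → q ∈ I → β q ≡ β₀ q) × ∃[ L ] Cut (family β) (root P) depth v L × I ⊆ L

  Tree : ℕ → (Fin n → Bool) → List (Fin n) → Set
  Tree k β I = ∃[ vs ] length vs ≡ 2 ^ k × Unique vs × All (Witness β I) vs

  witness-weaken : ∀ {β I i b N v} → i ∉ I →
                   Witness (updateAt β i (const b)) (I ++ i ∷ N) v → Witness β I v
  witness-weaken {β} {I} {i} i∉I (β′ , agree , L , c , I′⊆L) =
    β′ , (λ q q∈I → trans (agree q (∈-++⁺ˡ q∈I)) (updateAt-minimal q i β λ { refl → i∉I q∈I })) ,
    L , c , (λ q∈I → I′⊆L (∈-++⁺ˡ q∈I))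

  witnesses-differ : ∀ {β I i N N′ v} → Middle i →
                     Witness (updateAt β i (const false)) (I ++ i ∷ N) v →
                     Witness (updateAt β i (const true)) (I ++ i ∷ N′) v → ⊥
  witnesses-differ {β} {I} {i} mi (β₁ , agree₁ , _ , c₁ , ⊆₁) (β₂ , agree₂ , _ , c₂ , ⊆₂) =
    cuts-separate c₁ c₂ mi (⊆₁ i∈) (⊆₂ i∈) differ
    where
    i∈ : ∀ {N} → i ∈ I ++ i ∷ N
    i∈ = ∈-++⁺ʳ I (here refl)
    differ : β₁ i ≢ β₂ i
    differ eq with trans (sym (trans (agree₁ i i∈) (updateAt-updates i β)))
                         (trans eq (trans (agree₂ i i∈) (updateAt-updates i β)))
    ... | ()

  j<depth : ∀ {j k} → j + suc k ≡ depth → j < depth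
  j<depth {j} eq = subst (j <_) eq (m<m+n j (s≤s z≤n))

  join : ∀ {k β I i} → Middle i → i ∉ I →
         ∃[ N ] Tree k (updateAt β i (const false)) (I ++ i ∷ N) →
         ∃[ N ] Tree k (updateAt β i (const true)) (I ++ i ∷ N) → Tree (suc k) β I
  join {k} mi i∉I (_ , vs₀ , len₀ , unique₀ , ws₀) (_ , vs₁ , len₁ , unique₁ , ws₁) =
    vs₀ ++ vs₁ ,
    trans (length-++ vs₀) (trans (cong₂ _+_ len₀ len₁) (cong (2 ^ k +_) (sym (+-identityʳ (2 ^ k))))) ,
    Unique.++⁺ unique₀ unique₁
      (λ (v∈₀ , v∈₁) → witnesses-differ mi (All.lookup ws₀ v∈₀) (All.lookup ws₁ v∈₁)) ,
    All.++⁺ (All.map (witness-weaken i∉I) ws₀) (All.map (witness-weaken i∉I) ws₁)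

  tree : ∀ k {j β u I} → j + k ≡ depth → Cut (family β) (root P) j u I → Tree k β I
  tree zero {j} {β} {u} {I} j+0≡depth c =
    u ∷ [] , refl , [] ∷ [] , (β , (λ _ _ → refl) , I , c′ , λ q∈ → q∈) ∷ []
    where
    c′ : Cut (family β) (root P) depth u I
    c′ = subst (λ d → Cut (family β) (root P) d u I) (trans (sym (+-identityʳ j)) j+0≡depth) c
  tree (suc k) {j} {β} {u} {I} j+k+1≡depth c with cut-step (j<depth j+k+1≡depth) c
  ... | i , e , nq , mi , i∉I , _ = join {k} mi i∉I (subtree false) (subtree true)
    where
    subtree : ∀ b → ∃[ N ] Tree k (updateAt β i (const b)) (I ++ i ∷ N)
    agree-on-I : ∀ b q → q ∈ I → family (updateAt β i (const b)) q ≡ family β q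
    agree-on-I b q q∈I = family-cong q (updateAt-minimal q i β λ { refl → i∉I q∈I })
    subtree b with cut-step (j<depth j+k+1≡depth) (cut-cong (agree-on-I b) c)
    ... | _ , _ , nq′ , _ , _ , _ , N , c′ with trans (sym nq) nq′
    ...   | refl = N , tree k (trans (sym (+-suc j k)) j+k+1≡depth) c′

  size-bound : 2 ^ depth ≤ s
  size-bound with cut-at (const false) z≤n
  ... | _ , _ , c with tree depth refl c
  ...   | vs , length≡ , unique , _ = subst (_≤ s) length≡ (Unique⇒length≤ unique)

layout-fits : ∀ d n → 3 ≤ d → d * 7 ≤ n → suc (d + d) + suc (d + d) + suc (d + d) ≤ n
layout-fits d n 3≤d 7d≤n = begin
  suc (d + d) + suc (d + d) + suc (d + d) ≡⟨ 3t≡3+6d d ⟩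
  3 + d * 6                               ≤⟨ +-monoˡ-≤ (d * 6) 3≤d ⟩
  d + d * 6                               ≡⟨ d+6d≡7d d ⟩
  d * 7                                   ≤⟨ 7d≤n ⟩
  n                                       ∎
  where
  open ≤-Reasoning
  3t≡3+6d : ∀ d → suc (d + d) + suc (d + d) + suc (d + d) ≡ 3 + d * 6
  3t≡3+6d = solve-∀
  d+6d≡7d : ∀ d → d + d * 6 ≡ d * 7
  d+6d≡7d = solve-∀

≤-eighth-of-sevenths : ∀ n → 6 ≤ n / 7 → n ≤ n / 7 * 8
≤-eighth-of-sevenths n 6≤d = begin
  n                     ≡⟨ m≡m%n+[m/n]*n n 7 ⟩
  n % 7 + n / 7 * 7     ≤⟨ +-monoˡ-≤ (n / 7 * 7) (≤-trans (≤-pred (m%n<n n 7)) 6≤d) ⟩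
  n / 7 + n / 7 * 7     ≡⟨ d+7d≡8d (n / 7) ⟩
  n / 7 * 8             ∎
  where
  open ≤-Reasoning
  d+7d≡8d : ∀ d → d + d * 7 ≡ d * 8
  d+7d≡8d = solve-∀

lower-bound : ∀ {n m s} (P : BP n m s) → ReadOnce P → ComputesLIS P → 42 ≤ n → n < m →
              2 ^ n ≤ s ^ 8
lower-bound {n} {m} {s} P read-once computes 42≤n n<m = begin
  2 ^ n          ≤⟨ ^-monoʳ-≤ 2 (≤-eighth-of-sevenths n 6≤d) ⟩
  2 ^ (d * 8)    ≡⟨ ^-*-assoc 2 d 8 ⟨
  (2 ^ d) ^ 8    ≤⟨ ^-monoˡ-≤ 8 (size-bound (suc (d + d)) 3t≤n n<m P read-once computes d ≤-refl) ⟩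
  s ^ 8          ∎
  where
  open ≤-Reasoning
  open Fooling using (size-bound)
  d : ℕ
  d = n / 7
  6≤d : 6 ≤ d
  6≤d = /-mono-≤ {o = 7} {p = 7} 42≤n ≤-refl
  3t≤n : suc (d + d) + suc (d + d) + suc (d + d) ≤ n
  3t≤n = layout-fits d n (≤-trans (s≤s (s≤s (s≤s z≤n))) 6≤d) (m/n*n≤m n 7)

theorem1 : Σ ℕ λ c → Σ ℕ λ N →
    ∀ n → N ≤ n → ∀ m → n < m → ∀ s (P : BP n m s) →
      ReadOnce P → ComputesLIS P → 2 ^ n ≤ s ^ suc c
theorem1 = 7 , 42 , λ n 42≤n m n<m s P read-once computes → lower-bound P read-once computes 42≤n n<m
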